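{- Let $B_4$ be the (weak) Bruhat graph of order 4. Then $\pi(B_4)\le 72$.
   Context: The weak Bruhat graph $B_m$ of order $m$ has as vertices all permutations of $\{1,\dots,m\}$, with two permutations adjacent when they differ by an adjacent transposition (i.e. $B_m$ is the Cayley graph of the symmetric group $S_m$ generated by the transpositions $(i\ i+1)$, $1\le i<m$). A configuration on a connected graph $G$ is a function $C:V(G)\to\mathbb{N}$; a pebbling step from $u$ to a neighbor $v$ removes two pebbles from $u$ and adds one to $v$; $C$ is $r$-solvable if some sequence of pebbling steps places a pebble on $r$. $\pi(G,r)$ is the minimum $t$ such that every configuration with $t$ pebbles in total is $r$-solvable, and $\pi(G)=\max_r\pi(G,r)$. -}

module Defs where

open import Data.Nat using (ℕ; zero; suc; _+_; _∸_; _≤_; _<_)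
open import Data.Nat.Properties using (<⇒≤; ≤-refl)
open import Data.Fin using (Fin; fromℕ<)
import Data.Fin.Properties as FinP
open import Data.Vec using (Vec; []; _∷_; lookup; _[_]≔_; toList)
import Data.Vec.Properties as VecP
open import Data.Vec.Relation.Unary.Unique.Propositional using (Unique)
open import Data.Vec.Relation.Unary.AllPairs using (allPairs?)
open import Data.Nat.ListAction using (sum)
open import Data.List using (List; []; _∷_; map; concatMap; mapMaybe)
open import Data.Maybe using (Maybe; just; nothing)
open import Data.Product using (Σ; ∃; _×_; _,_)
open import Data.Bool using (if_then_else_)
open import Relation.Nullary using (yes; no; ¬?; does)
open import Relation.Binary.PropositionalEquality using (_≡_; refl; _≢_)
open import Relation.Binary.Definitions using (DecidableEquality)
open import Relation.Binary.Construct.Closure.ReflexiveTransitive using (Star)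

-- Graph pebbling on a finite graph with vertex type V, a decidable
-- equality on V, an adjacency relation, and a list enumerating V
-- (each vertex exactly once).

module Pebbling {V : Set} (_≟V_ : DecidableEquality V)
                (Adj : V → V → Set) (vertices : List V) where

  Configuration : Set
  Configuration = V → ℕ

  δ : V → V → ℕ
  δ a b = if does (a ≟V b) then 1 else 0

  size : Configuration → ℕ
  size C = sum (map C vertices)

  Step : Configuration → Configuration → Set
  Step C C′ = Σ V λ u → Σ V λ v →
    Adj u v × 2 ≤ C u × (∀ w → C′ w ≡ (C w ∸ 2 * δ w u) + δ w v)
    where open import Data.Nat using (_*_)

  Reachable : Configuration → Configuration → Set
  Reachable = Star Step

  Solvable : Configuration → V → Set
  Solvable C r = Σ Configuration λ C′ → Reachable C C′ × 1 ≤ C′ r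

  -- π(G,r) ≤ t : the minimum s such that every configuration with s
  -- pebbles is r-solvable is at most t, i.e. some s ≤ t has that property
  PebblingNumberAt≤ : V → ℕ → Set
  PebblingNumberAt≤ r t =
    Σ ℕ λ s → s ≤ t × (∀ (C : Configuration) → size C ≡ s → Solvable C r)

  PebblingNumber≤ : ℕ → Set
  PebblingNumber≤ t = ∀ r → PebblingNumberAt≤ r t

-- A permutation of {1..m} is represented in
-- one-line notation as a vector (w 1, ..., w m) of distinct elements of
-- Fin m.  The proof of distinctness is irrelevant, so two permutations
-- are equal iff their one-line vectors are equal.

record Perm (m : ℕ) : Set where
  constructor perm
  field
    word       : Vec (Fin m) m
    .distinct  : Unique word
open Perm public

_≟Perm_ : ∀ {m} → DecidableEquality (Perm m)
perm u _ ≟Perm perm v _ with VecP.≡-dec FinP._≟_ u v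
... | yes refl = yes refl
... | no  u≢v  = no λ { refl → u≢v refl }

swapAdj : ∀ {m} (i : ℕ) → suc i < m → Vec (Fin m) m → Vec (Fin m) m
swapAdj i p w =
  (w [ a ]≔ lookup w b) [ b ]≔ lookup w a
  where
  a = fromℕ< (<⇒≤ p)
  b = fromℕ< p

BruhatAdj : ∀ {m} → Perm m → Perm m → Set
BruhatAdj {m} u v =
  Σ ℕ λ i → Σ (suc i < m) λ p → word v ≡ swapAdj i p (word u)

allWords : ∀ m n → List (Vec (Fin m) n)
allWords m zero    = [] ∷ []
allWords m (suc n) =
  concatMap (λ w → map (λ x → x ∷ w) (toList (Data.Vec.allFin m))) (allWords m n)
  where import Data.Vec

permutations : ∀ m → List (Perm m)
permutations m = mapMaybe toPerm (allWords m m)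
  where
  toPerm : Vec (Fin m) m → Maybe (Perm m)
  toPerm w with allPairs? (λ x y → ¬? (x FinP.≟ y)) w
  ... | yes d = just (perm w d)
  ... | no  _ = nothing

module BruhatPebbling (m : ℕ) =
  Pebbling (_≟Perm_ {m}) (BruhatAdj {m}) (permutations m)

-- Hurlbert's weight function lemma.  A strategy for a root r is a list of edges, each
-- oriented towards r, together with weights w that at least double along every edge.
-- Pushing pebbles greedily along the edges, in order, never decreases Σ w(v) C(v); if r is
-- still empty afterwards, every vertex of positive weight other than r holds at most one
-- pebble, so Σ w(v) C(v) ≤ Σ_{v ≠ r} w(v).  For B₄ eight strategies per root have weights
-- adding up to at least 8 at every vertex and bounds adding up to 520, so an unsolvable
-- configuration has at most 520 / 8 = 65 pebbles.  The strategies are written down for the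
-- identity root only: left multiplication is an automorphism of the Cayley graph B₄, so it
-- transports them to every other root, and each transported family is checked by evaluation.

module Submission where

open import Data.Bool using (if_then_else_)
open import Data.Empty using (⊥; ⊥-elim)
import Data.Empty.Irrelevant as Irrelevant
open import Data.Fin using (Fin; zero; suc)
import Data.Fin.Properties as FinP
open import Data.List using (List; []; _∷_; map; mapMaybe)
open import Data.List.Membership.Propositional using (_∈_)
open import Data.List.Properties using (map-cong)
open import Data.List.Relation.Unary.All as All using (All; []; _∷_; all?)
import Data.List.Relation.Unary.Any as Any
open import Data.List.Relation.Unary.Any.Properties using (concatMap⁺; map⁺; mapMaybe⁺)
open import Data.Maybe using (Maybe; just; nothing; _<∣>_; _>>=_)
import Data.Maybe as Maybe
import Data.Maybe.Relation.Unary.Any as MaybeAny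
open import Data.Nat
open import Data.Nat.ListAction using (sum)
open import Data.Nat.Properties
open import Algebra.Properties.CommutativeSemigroup +-commutativeSemigroup using (interchange)
open import Data.Product using (_×_; _,_)
open import Data.Sum using (_⊎_; inj₁; inj₂)
import Data.Sum as Sum
open import Data.Vec as Vec using (Vec; []; _∷_; lookup)
import Data.Vec.Membership.Propositional.Properties as VecMem
import Data.Vec.Properties as VecP
open import Data.Vec.Relation.Unary.AllPairs using (allPairs?)
open import Function using (_∘_)
open import Relation.Binary.Construct.Closure.ReflexiveTransitive using (ε; _◅_; _◅◅_)
open import Relation.Binary.Definitions using (DecidableEquality)
open import Relation.Binary.PropositionalEquality
open import Relation.Nullary using (Dec; yes; no; ¬?; does; contradiction)
open import Relation.Nullary.Decidable using (_×-dec_; _⊎-dec_; map′; from-yes; dec⇒maybe)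

open import Defs

2*⌊n/2⌋≤n : ∀ n → 2 * ⌊ n /2⌋ ≤ n
2*⌊n/2⌋≤n zero          = z≤n
2*⌊n/2⌋≤n (suc zero)    = z≤n
2*⌊n/2⌋≤n (suc (suc n)) rewrite *-suc 2 ⌊ n /2⌋ = s≤s (s≤s (2*⌊n/2⌋≤n n))

n∸2*⌊n/2⌋≤1 : ∀ n → n ∸ 2 * ⌊ n /2⌋ ≤ 1
n∸2*⌊n/2⌋≤1 zero          = z≤n
n∸2*⌊n/2⌋≤1 (suc zero)    = s≤s z≤n
n∸2*⌊n/2⌋≤1 (suc (suc n)) =
  subst (λ m → suc (suc n) ∸ m ≤ 1) (sym (*-suc 2 ⌊ n /2⌋)) (n∸2*⌊n/2⌋≤1 n)

module _ {A : Set} where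

  sum-map-+ : ∀ (f g : A → ℕ) xs →
              sum (map (λ x → f x + g x) xs) ≡ sum (map f xs) + sum (map g xs)
  sum-map-+ f g []       = refl
  sum-map-+ f g (x ∷ xs) = begin
    f x + g x + sum (map (λ x → f x + g x) xs)   ≡⟨ cong (f x + g x +_) (sum-map-+ f g xs) ⟩
    f x + g x + (sum (map f xs) + sum (map g xs)) ≡⟨ interchange (f x) (g x) _ _ ⟩
    f x + sum (map f xs) + (g x + sum (map g xs)) ∎
    where open ≡-Reasoning

  sum-map-* : ∀ k (f : A → ℕ) xs → sum (map (λ x → k * f x) xs) ≡ k * sum (map f xs)
  sum-map-* k f []       = sym (*-zeroʳ k)
  sum-map-* k f (x ∷ xs) = trans (cong (k * f x +_) (sum-map-* k f xs))
                                 (sym (*-distribˡ-+ k (f x) (sum (map f xs))))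

  sum-map-cong : ∀ {f g : A → ℕ} → (∀ x → f x ≡ g x) → ∀ xs → sum (map f xs) ≡ sum (map g xs)
  sum-map-cong f≗g xs = cong sum (map-cong f≗g xs)

  sum-map-mono : ∀ {f g : A → ℕ} {xs} → All (λ x → f x ≤ g x) xs → sum (map f xs) ≤ sum (map g xs)
  sum-map-mono []           = z≤n
  sum-map-mono (fx≤gx ∷ ps) = +-mono-≤ fx≤gx (sum-map-mono ps)

a*[x∸2]+2*a≡a*x : ∀ a {x} → 2 ≤ x → a * (x ∸ 2) + 2 * a ≡ a * x
a*[x∸2]+2*a≡a*x a (s≤s (s≤s {n = y} _)) = begin
  a * y + 2 * a ≡⟨ +-comm (a * y) (2 * a) ⟩
  2 * a + a * y ≡⟨ cong (_+ a * y) (*-comm 2 a) ⟩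
  a * 2 + a * y ≡⟨ *-distribˡ-+ a 2 y ⟨
  a * (2 + y)   ∎
  where open ≡-Reasoning

module WeightFunctionLemma
  {V : Set} (_≟V_ : DecidableEquality V) (Adj : V → V → Set) (vertices : List V)
  where

  open Pebbling _≟V_ Adj vertices

  δ-refl : ∀ a → δ a a ≡ 1
  δ-refl a with a ≟V a
  ... | yes _   = refl
  ... | no  a≢a = ⊥-elim (a≢a refl)

  δ-≢ : ∀ {a b} → a ≢ b → δ a b ≡ 0
  δ-≢ {a} {b} a≢b with a ≟V b
  ... | yes a≡b = ⊥-elim (a≢b a≡b)
  ... | no  _   = refl

  ∑ : (V → ℕ) → ℕ
  ∑ f = sum (map f vertices)

  multiplicity : V → ℕ
  multiplicity v = ∑ (λ u → δ u v)

  Φ : (V → ℕ) → Configuration → ℕ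
  Φ w C = ∑ (λ u → w u * C u)

  Φ-+ : ∀ (w w′ : V → ℕ) C → Φ (λ u → w u + w′ u) C ≡ Φ w C + Φ w′ C
  Φ-+ w w′ C = trans (sum-map-cong (λ u → *-distribʳ-+ (C u) (w u) (w′ u)) vertices)
                     (sum-map-+ (λ u → w u * C u) (λ u → w′ u * C u) vertices)

  record Edge : Set where
    field
      child parent : V
      adjacent     : Adj child parent
      child≢parent : child ≢ parent
  open Edge

  push : Edge → Configuration → Configuration
  push e C u = (C u ∸ 2 * δ u (child e)) + δ u (parent e)

  push-step : ∀ e C → 2 ≤ C (child e) → Step C (push e C)
  push-step e C 2≤C[c] = child e , parent e , adjacent e , 2≤C[c] , λ _ → refl

  push-child : ∀ e C → push e C (child e) ≡ C (child e) ∸ 2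
  push-child e C rewrite δ-refl (child e) | δ-≢ (child≢parent e) = +-identityʳ _

  push-≢parent : ∀ e C {u} → u ≢ parent e → push e C u ≤ C u
  push-≢parent e C {u} u≢p rewrite δ-≢ u≢p | +-identityʳ (C u ∸ 2 * δ u (child e)) =
    m∸n≤m (C u) (2 * δ u (child e))

  push-weighted : ∀ e (w : V → ℕ) C u → 2 ≤ C (child e) →
    w u * push e C u + 2 * w (child e) * δ u (child e) ≡ w u * C u + w (parent e) * δ u (parent e)
  push-weighted e w C u 2≤C[c] with u ≟V child e | u ≟V parent e
  ... | yes refl | yes u≡p = ⊥-elim (child≢parent e u≡p)
  ... | yes refl | no _    = begin
    w u * (C u ∸ 2 + 0) + 2 * w u * 1
      ≡⟨ cong₂ _+_ (cong (w u *_) (+-identityʳ (C u ∸ 2))) (*-identityʳ (2 * w u)) ⟩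
    w u * (C u ∸ 2) + 2 * w u         ≡⟨ a*[x∸2]+2*a≡a*x (w u) 2≤C[c] ⟩
    w u * C u                         ≡⟨ +-identityʳ (w u * C u) ⟨
    w u * C u + 0                     ≡⟨ cong (w u * C u +_) (*-zeroʳ (w (parent e))) ⟨
    w u * C u + w (parent e) * 0      ∎
    where open ≡-Reasoning
  ... | no _     | yes refl = begin
    w u * (C u + 1) + 2 * w (child e) * 0 ≡⟨ cong (w u * (C u + 1) +_) (*-zeroʳ (2 * w (child e))) ⟩
    w u * (C u + 1) + 0                   ≡⟨ +-identityʳ (w u * (C u + 1)) ⟩
    w u * (C u + 1)                       ≡⟨ *-distribˡ-+ (w u) (C u) 1 ⟩
    w u * C u + w u * 1                   ∎
    where open ≡-Reasoning
  ... | no _     | no _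
    rewrite +-identityʳ (C u) | *-zeroʳ (2 * w (child e)) | *-zeroʳ (w (parent e)) = refl

  Φ-push : ∀ e w C → 2 ≤ C (child e) →
    Φ w (push e C) + 2 * w (child e) * multiplicity (child e) ≡ Φ w C + w (parent e) * multiplicity (parent e)
  Φ-push e w C 2≤C[c] = begin
    Φ w (push e C) + 2 * w c * multiplicity c
      ≡⟨ cong (Φ w (push e C) +_) (sum-map-* (2 * w c) (λ u → δ u c) vertices) ⟨
    Φ w (push e C) + ∑ (λ u → 2 * w c * δ u c)
      ≡⟨ sum-map-+ (λ u → w u * push e C u) (λ u → 2 * w c * δ u c) vertices ⟨
    ∑ (λ u → w u * push e C u + 2 * w c * δ u c)
      ≡⟨ sum-map-cong (λ u → push-weighted e w C u 2≤C[c]) vertices ⟩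
    ∑ (λ u → w u * C u + w p * δ u p)
      ≡⟨ sum-map-+ (λ u → w u * C u) (λ u → w p * δ u p) vertices ⟩
    Φ w C + ∑ (λ u → w p * δ u p)
      ≡⟨ cong (Φ w C +_) (sum-map-* (w p) (λ u → δ u p) vertices) ⟩
    Φ w C + w p * multiplicity p ∎
    where
    open ≡-Reasoning
    c = child e
    p = parent e

  pushₙ : ℕ → Edge → Configuration → Configuration
  pushₙ zero    e C = C
  pushₙ (suc k) e C = pushₙ k e (push e C)

  pushₙ-child : ∀ k e C → pushₙ k e C (child e) ≡ C (child e) ∸ 2 * k
  pushₙ-child zero    e C = refl
  pushₙ-child (suc k) e C = begin
    pushₙ k e (push e C) (child e) ≡⟨ pushₙ-child k e (push e C) ⟩
    push e C (child e) ∸ 2 * k     ≡⟨ cong (_∸ 2 * k) (push-child e C) ⟩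
    C (child e) ∸ 2 ∸ 2 * k        ≡⟨ ∸-+-assoc (C (child e)) 2 (2 * k) ⟩
    C (child e) ∸ (2 + 2 * k)      ≡⟨ cong (C (child e) ∸_) (*-suc 2 k) ⟨
    C (child e) ∸ 2 * suc k        ∎
    where open ≡-Reasoning

  push-budget : ∀ k e C → 2 * suc k ≤ C (child e) → 2 ≤ C (child e) × 2 * k ≤ push e C (child e)
  push-budget k e C 2[k+1]≤ = m+n≤o⇒m≤o 2 2+2k≤ , 2k≤
    where
    2+2k≤ : 2 + 2 * k ≤ C (child e)
    2+2k≤ = subst (_≤ C (child e)) (*-suc 2 k) 2[k+1]≤
    2k≤ : 2 * k ≤ push e C (child e)
    2k≤ = subst (2 * k ≤_) (sym (push-child e C))
                (m+n≤o⇒m≤o∸n (2 * k) (subst (_≤ C (child e)) (+-comm 2 (2 * k)) 2+2k≤))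

  pushₙ-reachable : ∀ k e C → 2 * k ≤ C (child e) → Reachable C (pushₙ k e C)
  pushₙ-reachable zero    e C _         = ε
  pushₙ-reachable (suc k) e C 2[k+1]≤ with push-budget k e C 2[k+1]≤
  ... | 2≤ , 2k≤ = push-step e C 2≤ ◅ pushₙ-reachable k e (push e C) 2k≤

  pushₙ-≢parent : ∀ k e C {u} → u ≢ parent e → pushₙ k e C u ≤ C u
  pushₙ-≢parent zero    e C u≢p = ≤-refl
  pushₙ-≢parent (suc k) e C u≢p =
    ≤-trans (pushₙ-≢parent k e (push e C) u≢p) (push-≢parent e C u≢p)

  pushAll : Edge → Configuration → Configuration
  pushAll e C = pushₙ ⌊ C (child e) /2⌋ e C

  pushAll-reachable : ∀ e C → Reachable C (pushAll e C)
  pushAll-reachable e C = pushₙ-reachable ⌊ C (child e) /2⌋ e C (2*⌊n/2⌋≤n (C (child e)))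

  pushAll-child : ∀ e C → pushAll e C (child e) ≤ 1
  pushAll-child e C rewrite pushₙ-child ⌊ C (child e) /2⌋ e C = n∸2*⌊n/2⌋≤1 (C (child e))

  run : List Edge → Configuration → Configuration
  run []       C = C
  run (e ∷ es) C = run es (pushAll e C)

  run-reachable : ∀ es C → Reachable C (run es C)
  run-reachable []       C = ε
  run-reachable (e ∷ es) C = pushAll-reachable e C ◅◅ run-reachable es (pushAll e C)

  NotParentIn : V → List Edge → Set
  NotParentIn u = All (λ e → u ≢ parent e)

  LastChildIn : V → List Edge → Set
  LastChildIn u []       = ⊥
  LastChildIn u (e ∷ es) = (u ≡ child e × NotParentIn u es) ⊎ LastChildIn u es

  run-notParent : ∀ es C {u} → NotParentIn u es → run es C u ≤ C u
  run-notParent []       C []              = ≤-refl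
  run-notParent (e ∷ es) C (u≢p ∷ u∉parents) =
    ≤-trans (run-notParent es (pushAll e C) u∉parents) (pushₙ-≢parent ⌊ C (child e) /2⌋ e C u≢p)

  run-lastChild : ∀ es C {u} → LastChildIn u es → run es C u ≤ 1
  run-lastChild (e ∷ es) C (inj₁ (refl , u∉parents)) =
    ≤-trans (run-notParent es (pushAll e C) u∉parents) (pushAll-child e C)
  run-lastChild (e ∷ es) C (inj₂ later) = run-lastChild es (pushAll e C) later

  notParentIn? : ∀ u es → Dec (NotParentIn u es)
  notParentIn? u = all? (λ e → ¬? (u ≟V parent e))

  lastChildIn? : ∀ u es → Dec (LastChildIn u es)
  lastChildIn? u []       = no λ ()
  lastChildIn? u (e ∷ es) = ((u ≟V child e) ×-dec notParentIn? u es) ⊎-dec lastChildIn? u es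

  record Strategy : Set where
    field
      edges  : List Edge
      weight : V → ℕ
  open Strategy

  offRoot : V → (V → ℕ) → V → ℕ
  offRoot r w u = if does (u ≟V r) then 0 else w u

  Doubling : (V → ℕ) → Edge → Set
  Doubling w e = 2 * w (child e) ≤ w (parent e)

  record IsValid (r : V) (s : Strategy) : Set where
    field
      doubling  : All (Doubling (weight s)) (edges s)
      exhausted : All (λ u → u ≡ r ⊎ weight s u ≡ 0 ⊎ LastChildIn u (edges s)) vertices
  open IsValid

  isValid? : ∀ r s → Dec (IsValid r s)
  isValid? r s = map′ (λ (d , x) → record { doubling = d ; exhausted = x })
                      (λ v → doubling v , exhausted v)
                      (all? (λ e → 2 * weight s (child e) ≤? weight s (parent e)) (edges s)
                        ×-dec all? (λ u → (u ≟V r) ⊎-dec (weight s u ≟ 0) ⊎-dec lastChildIn? u (edges s))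
                                   vertices)

  totalWeight : List Strategy → V → ℕ
  totalWeight ss u = sum (map (λ s → weight s u) ss)

  totalBound : V → List Strategy → ℕ
  totalBound r ss = sum (map (λ s → ∑ (offRoot r (weight s))) ss)

  record Certifies (r : V) (K t : ℕ) (ss : List Strategy) : Set where
    field
      valid    : All (IsValid r) ss
      covering : All (λ u → K ≤ totalWeight ss u) vertices
      bounded  : totalBound r ss < K * t
  open Certifies

  certifies? : ∀ r K t ss → Dec (Certifies r K t ss)
  certifies? r K t ss =
    map′ (λ (v , c , b) → record { valid = v ; covering = c ; bounded = b })
         (λ cert → valid cert , covering cert , bounded cert)
         (all? (isValid? r) ss
           ×-dec all? (λ u → K ≤? totalWeight ss u) vertices
           ×-dec totalBound r ss <? K * t)

  offRoot-bound : ∀ {r} w (D : Configuration) {u} → D r ≡ 0 →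
                  u ≡ r ⊎ w u ≡ 0 ⊎ D u ≤ 1 → w u * D u ≤ offRoot r w u
  offRoot-bound {r} w D {u} D[r]≡0 cases with u ≟V r | cases
  ... | yes refl | _                  = ≤-reflexive (trans (cong (w u *_) D[r]≡0) (*-zeroʳ (w u)))
  ... | no u≢r   | inj₁ u≡r           = contradiction u≡r u≢r
  ... | no _     | inj₂ (inj₁ w[u]≡0) rewrite w[u]≡0 = z≤n
  ... | no _     | inj₂ (inj₂ D[u]≤1) = ≤-trans (*-monoʳ-≤ (w u) D[u]≤1) (≤-reflexive (*-identityʳ (w u)))

  module _ (occurs-once : ∀ v → multiplicity v ≡ 1) where

    Φ-push-balance : ∀ e w C → 2 ≤ C (child e) → Φ w (push e C) + 2 * w (child e) ≡ Φ w C + w (parent e)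
    Φ-push-balance e w C 2≤C[c] with Φ-push e w C 2≤C[c]
    ... | balance rewrite occurs-once (child e) | occurs-once (parent e)
                        | *-identityʳ (2 * w (child e)) | *-identityʳ (w (parent e)) = balance

    Φ-push-mono : ∀ e w C → Doubling w e → 2 ≤ C (child e) → Φ w C ≤ Φ w (push e C)
    Φ-push-mono e w C doubles 2≤C[c] = +-cancelʳ-≤ (2 * w (child e)) _ _ (begin
      Φ w C + 2 * w (child e)          ≤⟨ +-monoʳ-≤ (Φ w C) doubles ⟩
      Φ w C + w (parent e)             ≡⟨ Φ-push-balance e w C 2≤C[c] ⟨
      Φ w (push e C) + 2 * w (child e) ∎)
      where open ≤-Reasoning

    Φ-pushₙ-mono : ∀ k e w C → Doubling w e → 2 * k ≤ C (child e) → Φ w C ≤ Φ w (pushₙ k e C)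
    Φ-pushₙ-mono zero    e w C doubles _     = ≤-refl
    Φ-pushₙ-mono (suc k) e w C doubles 2[k+1]≤ with push-budget k e C 2[k+1]≤
    ... | 2≤ , 2k≤ = ≤-trans (Φ-push-mono e w C doubles 2≤) (Φ-pushₙ-mono k e w (push e C) doubles 2k≤)

    Φ-run-mono : ∀ es w C → All (Doubling w) es → Φ w C ≤ Φ w (run es C)
    Φ-run-mono []       w C []                  = ≤-refl
    Φ-run-mono (e ∷ es) w C (doubles ∷ doubling) =
      ≤-trans (Φ-pushₙ-mono ⌊ C (child e) /2⌋ e w C doubles (2*⌊n/2⌋≤n (C (child e))))
              (Φ-run-mono es w (pushAll e C) doubling)

    weight-function-lemma : ∀ {r} s → IsValid r s → ∀ C →
                            Solvable C r ⊎ Φ (weight s) C ≤ ∑ (offRoot r (weight s))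
    weight-function-lemma {r} s valid C with run (edges s) C r in D[r]≡
    ... | suc _ = inj₁ (run (edges s) C , run-reachable (edges s) C , subst (1 ≤_) (sym D[r]≡) (s≤s z≤n))
    ... | zero  = inj₂ (begin
      Φ (weight s) C         ≤⟨ Φ-run-mono (edges s) (weight s) C (doubling valid) ⟩
      Φ (weight s) D         ≤⟨ sum-map-mono (All.map (offRoot-bound (weight s) D D[r]≡
                                                        ∘ Sum.map₂ (Sum.map₂ (run-lastChild (edges s) C)))
                                                      (exhausted valid)) ⟩
      ∑ (offRoot r (weight s)) ∎)
      where
      open ≤-Reasoning
      D = run (edges s) C

    summed-weight-function-lemma : ∀ {r} ss → All (IsValid r) ss → ∀ C →
                             Solvable C r ⊎ Φ (totalWeight ss) C ≤ totalBound r ss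
    summed-weight-function-lemma []       []             C = inj₂ (≤-reflexive (sum-map-* 0 C vertices))
    summed-weight-function-lemma (s ∷ ss) (valid ∷ valids) C
      with weight-function-lemma s valid C | summed-weight-function-lemma ss valids C
    ... | inj₁ solvable | _             = inj₁ solvable
    ... | inj₂ _        | inj₁ solvable = inj₁ solvable
    ... | inj₂ Φ≤       | inj₂ Φs≤      =
      inj₂ (≤-trans (≤-reflexive (Φ-+ (weight s) (totalWeight ss) C)) (+-mono-≤ Φ≤ Φs≤))

    pebblingNumberAt≤ : ∀ {r K t} ss → Certifies r K t ss → PebblingNumberAt≤ r t
    pebblingNumberAt≤ {r} {K} {t} ss cert = t , ≤-refl , solvable
      where
      K*size≤Φ : ∀ C → K * size C ≤ Φ (totalWeight ss) C
      K*size≤Φ C = ≤-trans (≤-reflexive (sym (sum-map-* K C vertices)))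
                           (sum-map-mono (All.map (*-monoˡ-≤ _) (covering cert)))
      solvable : ∀ C → size C ≡ t → Solvable C r
      solvable C size≡t with summed-weight-function-lemma ss (valid cert) C
      ... | inj₁ solvable = solvable
      ... | inj₂ Φ≤       = contradiction (bounded cert)
        (≤⇒≯ (≤-trans (subst (λ n → K * n ≤ _) size≡t (K*size≤Φ C)) Φ≤))

allWords-complete : ∀ m n (w : Vec (Fin m) n) → w ∈ allWords m n
allWords-complete m zero    []      = Any.here refl
allWords-complete m (suc n) (x ∷ w) =
  concatMap⁺ _ (Any.map (λ { refl → map⁺ (Any.map (cong (_∷ w)) x∈allFin) }) (allWords-complete m n w))
  where x∈allFin = VecMem.∈-toList⁺ (VecMem.∈-allFin⁺ x)

asPermutation : ∀ {m} → Vec (Fin m) m → Maybe (Perm m)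
asPermutation w with allPairs? (λ x y → ¬? (x FinP.≟ y)) w
... | yes distinct = just (perm w distinct)
... | no  _        = nothing

asPermutation-word : ∀ {m} (r : Perm m) → asPermutation (word r) ≡ just r
asPermutation-word (perm w distinct) with allPairs? (λ x y → ¬? (x FinP.≟ y)) w
... | yes _            = refl
... | no  ¬distinct    = Irrelevant.⊥-elim (¬distinct distinct)

asPermutation-complete : ∀ {m} (r : Perm m) → r ∈ mapMaybe asPermutation (allWords m m)
asPermutation-complete {m} r =
  mapMaybe⁺ asPermutation _ (map⁺ (Any.map accepted (allWords-complete m m (word r))))
  where
  accepted : ∀ {w} → word r ≡ w → MaybeAny.Any (r ≡_) (asPermutation w)
  accepted refl = subst (MaybeAny.Any (r ≡_)) (sym (asPermutation-word r)) (MaybeAny.just refl)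

-- permutations 4 and mapMaybe asPermutation (allWords 4 4) evaluate to the same list.
∈-permutations₄ : ∀ (r : Perm 4) → r ∈ permutations 4
∈-permutations₄ = asPermutation-complete

open WeightFunctionLemma (_≟Perm_ {4}) (BruhatAdj {4}) (permutations 4)

permutations₄-occur-once : ∀ v → multiplicity v ≡ 1
permutations₄-occur-once v =
  All.lookup (from-yes (all? (λ v → multiplicity v ≟ 1) (permutations 4))) (∈-permutations₄ v)

Word : Set
Word = Vec (Fin 4) 4

_≟Word_ : DecidableEquality Word
_≟Word_ = VecP.≡-dec FinP._≟_

-- One-line notation with digits 1..4: 4213 is the permutation 1 ↦ 4, 2 ↦ 2, 3 ↦ 1, 4 ↦ 3
-- (any other digit is read as 1).
oneLine : ℕ → Word
oneLine n = digit (n / 1000) ∷ digit (n / 100 % 10) ∷ digit (n / 10 % 10) ∷ digit (n % 10) ∷ []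
  where
  digit : ℕ → Fin 4
  digit 2 = suc zero
  digit 3 = suc (suc zero)
  digit 4 = suc (suc (suc zero))
  digit _ = zero

infixr 25 _·_

_·_ : Perm 4 → Word → Word
g · u = Vec.map (lookup (word g)) u

adjacent? : (u v : Perm 4) → Maybe (BruhatAdj u v)
adjacent? u v = swap 0 (s<s z<s) <∣> swap 1 (s<s (s<s z<s)) <∣> swap 2 (s<s (s<s (s<s z<s)))
  where
  swap : (i : ℕ) (i+1<4 : suc i < 4) → Maybe (BruhatAdj u v)
  swap i i+1<4 = Maybe.map (λ v≡ → i , i+1<4 , v≡) 
                   (dec⇒maybe (word v ≟Word swapAdj i i+1<4 (word u)))

edge? : Perm 4 → Perm 4 → Maybe Edge
edge? u v with adjacent? u v | u ≟Perm v
... | just u~v | no u≢v = just (record { child = u ; parent = v ; adjacent = u~v ; child≢parent = u≢v })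
... | _        | _      = nothing

StrategyData : Set
StrategyData = List (ℕ × ℕ) × List (ℕ × ℕ)

infix 6 _⟶_ _↦_

_⟶_ : ℕ → ℕ → ℕ × ℕ
u ⟶ v = u , v

_↦_ : ℕ → ℕ → ℕ × ℕ
u ↦ x = u , x

-- Strategies for the root 1234; the fourth one is used twice.
identityStrategies : List StrategyData
identityStrategies =
    ( 4321 ⟶ 3421 ∷ 4231 ⟶ 2431 ∷ 3421 ⟶ 3241 ∷ 2431 ⟶ 2341 ∷ 3241 ⟶ 2341 ∷ 2341 ⟶ 2314 ∷ 2314 ⟶ 2134
    ∷ 2134 ⟶ 1234 ∷ []
    , 4321 ↦ 1 ∷ 4231 ↦ 2 ∷ 3421 ↦ 2 ∷ 2431 ↦ 4 ∷ 3241 ↦ 4 ∷ 2341 ↦ 8 ∷ 2314 ↦ 16 ∷ 2134 ↦ 32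
    ∷ 1234 ↦ 64 ∷ [] )
  ∷ ( 4321 ⟶ 4231 ∷ 4231 ⟶ 2431 ∷ 2431 ⟶ 2413 ∷ 2413 ⟶ 2143 ∷ 2143 ⟶ 2134 ∷ 2134 ⟶ 1234 ∷ []
    , 4321 ↦ 1 ∷ 4231 ↦ 2 ∷ 2431 ↦ 4 ∷ 2413 ↦ 8 ∷ 2143 ↦ 16 ∷ 2134 ↦ 32 ∷ 1234 ↦ 64 ∷ [] )
  ∷ ( 4321 ⟶ 3421 ∷ 3421 ⟶ 3241 ∷ 3241 ⟶ 3214 ∷ 3214 ⟶ 3124 ∷ 3124 ⟶ 1324 ∷ 1324 ⟶ 1234 ∷ []
    , 4321 ↦ 1 ∷ 3421 ↦ 2 ∷ 3241 ↦ 4 ∷ 3214 ↦ 8 ∷ 3124 ↦ 16 ∷ 1324 ↦ 32 ∷ 1234 ↦ 64 ∷ [] )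
  ∷ ( 4321 ⟶ 3421 ∷ 3421 ⟶ 3412 ∷ 4312 ⟶ 3412 ∷ 3412 ⟶ 3142 ∷ 3142 ⟶ 3124 ∷ 3124 ⟶ 1324 ∷ 1324 ⟶ 1234
    ∷ []
    , 4321 ↦ 1 ∷ 3421 ↦ 2 ∷ 4312 ↦ 2 ∷ 3412 ↦ 4 ∷ 3142 ↦ 8 ∷ 3124 ↦ 16 ∷ 1324 ↦ 32 ∷ 1234 ↦ 64 ∷ [] )
  ∷ ( 4321 ⟶ 3421 ∷ 3421 ⟶ 3412 ∷ 4312 ⟶ 3412 ∷ 3412 ⟶ 3142 ∷ 3142 ⟶ 3124 ∷ 3124 ⟶ 1324 ∷ 1324 ⟶ 1234
    ∷ []
    , 4321 ↦ 1 ∷ 3421 ↦ 2 ∷ 4312 ↦ 2 ∷ 3412 ↦ 4 ∷ 3142 ↦ 8 ∷ 3124 ↦ 16 ∷ 1324 ↦ 32 ∷ 1234 ↦ 64 ∷ [] )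
  ∷ ( 4321 ⟶ 4312 ∷ 4312 ⟶ 4132 ∷ 4132 ⟶ 1432 ∷ 1432 ⟶ 1342 ∷ 1342 ⟶ 1324 ∷ 1324 ⟶ 1234 ∷ []
    , 4321 ↦ 1 ∷ 4312 ↦ 2 ∷ 4132 ↦ 4 ∷ 1432 ↦ 8 ∷ 1342 ↦ 16 ∷ 1324 ↦ 32 ∷ 1234 ↦ 64 ∷ [] )
  ∷ ( 4321 ⟶ 4231 ∷ 4231 ⟶ 4213 ∷ 4213 ⟶ 4123 ∷ 4123 ⟶ 1423 ∷ 1423 ⟶ 1243 ∷ 1243 ⟶ 1234 ∷ []
    , 4321 ↦ 1 ∷ 4231 ↦ 2 ∷ 4213 ↦ 4 ∷ 4123 ↦ 8 ∷ 1423 ↦ 16 ∷ 1243 ↦ 32 ∷ 1234 ↦ 64 ∷ [] )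
  ∷ ( 4321 ⟶ 4231 ∷ 4312 ⟶ 4132 ∷ 4231 ⟶ 4213 ∷ 4213 ⟶ 4123 ∷ 4132 ⟶ 4123 ∷ 4123 ⟶ 1423 ∷ 1423 ⟶ 1243
    ∷ 1243 ⟶ 1234 ∷ []
    , 4321 ↦ 1 ∷ 4231 ↦ 2 ∷ 4312 ↦ 2 ∷ 4213 ↦ 4 ∷ 4132 ↦ 4 ∷ 4123 ↦ 8 ∷ 1423 ↦ 16 ∷ 1243 ↦ 32
    ∷ 1234 ↦ 64 ∷ [] )
  ∷ []

-- Arcs that do not denote edges of B₄ are dropped; only the resulting strategy is certified.
translate : Perm 4 → StrategyData → Strategy
translate g (arcs , weights) = record { edges = mapMaybe arc arcs ; weight = weightOf weights }
  where
  arc : ℕ × ℕ → Maybe Edge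
  arc (u , v) = asPermutation (g · oneLine u) >>= λ u′ → asPermutation (g · oneLine v) >>= edge? u′
  weightOf : List (ℕ × ℕ) → Perm 4 → ℕ
  weightOf []             v = 0
  weightOf ((u , x) ∷ ws) v =
    if does (word v ≟Word g · oneLine u) then x else weightOf ws v

strategiesFor : Perm 4 → List Strategy
strategiesFor g = map (translate g) identityStrategies

allCertified : All (λ r → Certifies r 8 72 (strategiesFor r)) (permutations 4)
allCertified = from-yes (all? (λ r → certifies? r 8 72 (strategiesFor r)) (permutations 4))

theorem3p5 : BruhatPebbling.PebblingNumber≤ 4 72
theorem3p5 r =
  pebblingNumberAt≤ permutations₄-occur-once (strategiesFor r) (All.lookup allCertified (∈-permutations₄ r))
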